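{- Let $(X,\tau\circ\gamma,\mathcal{F})$ be an $\mathbb{F}$-augmented generalized closure space and $U$ a nonempty subset of $X$. Then the following are equivalent: (1) $U$ is an $\mathbb{F}$-regular open set; (2) the family $\{\langle F\rangle : F\in\mathcal{F},\ F\subseteq U\}$ is directed with respect to inclusion and its union is $U$.
   Context: A closure operator on $X$ is a map $\gamma:\mathcal{P}(X)\to\mathcal{P}(X)$ that is extensive, idempotent and monotone. A generalized closure space is a pair $(X,\tau\circ\gamma)$ where $\gamma$ is a closure operator and $\tau:\mathcal{P}(X)\to\mathcal{P}(X)$ satisfies for all $A,B\subseteq X$: $\tau(\gamma(A))\subseteq\gamma(A)$; $\tau(\tau(\gamma(A)))=\tau(\gamma(A))$; $A\subseteq B\Rightarrow\tau(\gamma(A))\subseteq\tau(\gamma(B))$. Write $\langle A\rangle=\tau(\gamma(A))$. An $\mathbb{F}$-augmented generalized closure space is a triple $(X,\tau\circ\gamma,\mathcal{F})$ with $(X,\tau\circ\gamma)$ a generalized closure space and $\mathcal{F}$ a nonempty family of finite subsets of $X$ such that for every $F\in\mathcal{F}$ and finite $M\subseteq\langle F\rangle$ there is $F_1\in\mathcal{F}$ with $M\subseteq\langle F_1\rangle$ and $F_1\subseteq\langle F\rangle$. An $\mathbb{F}$-regular open set is a nonempty $U\subseteq X$ such that for every finite $M\subseteq U$ (including $M=\emptyset$) there is $F\in\mathcal{F}$ with $M\subseteq\langle F\rangle\subseteq U$. A family of sets is directed if it is nonempty and any two members are contained in a common member. -}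

module Defs where

open import Level using (0ℓ)
open import Data.List using (List)
open import Data.List.Membership.Propositional using () renaming (_∈_ to _∈ₗ_)
open import Data.Product using (Σ; ∃; _×_; _,_)
open import Relation.Unary using (Pred; _⊆_; _∈_)

Subset : Set → Set₁
Subset X = Pred X 0ℓ

_≐_ : {X : Set} → Subset X → Subset X → Set
A ≐ B = (A ⊆ B) × (B ⊆ A)

-- Finite subsets of X are represented by lists; the subset denoted by a list.
⟦_⟧ : {X : Set} → List X → Subset X
⟦ L ⟧ = λ x → x ∈ₗ L

record IsClosureOperator {X : Set} (γ : Subset X → Subset X) : Set₁ where
  field
    extensive  : ∀ A → A ⊆ γ A
    idempotent : ∀ A → γ (γ A) ≐ γ A
    monotone   : ∀ {A B} → A ⊆ B → γ A ⊆ γ B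

record IsGenClosureSpace {X : Set} (τ γ : Subset X → Subset X) : Set₁ where
  field
    closure    : IsClosureOperator γ
    τ-resp-≐   : ∀ {A B} → A ≐ B → τ A ≐ τ B
    τ-deflat   : ∀ A → τ (γ A) ⊆ γ A
    τ-idem     : ∀ A → τ (τ (γ A)) ≐ τ (γ A)
    τγ-mono    : ∀ {A B} → A ⊆ B → τ (γ A) ⊆ τ (γ B)

⟨_⟩[_,_] : {X : Set} → Subset X → (τ γ : Subset X → Subset X) → Subset X
⟨ A ⟩[ τ , γ ] = τ (γ A)

-- The family 𝓕 of finite subsets is given as a predicate on lists:
-- a finite set F belongs to 𝓕 iff F = ⟦ L ⟧ for some list L with 𝓕 L.
record IsFAugmented {X : Set} (τ γ : Subset X → Subset X) (𝓕 : List X → Set) : Set₁ where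
  field
    gcs       : IsGenClosureSpace τ γ
    nonempty  : ∃ λ F → 𝓕 F
    augmented : ∀ F → 𝓕 F → ∀ (M : List X) → ⟦ M ⟧ ⊆ ⟨ ⟦ F ⟧ ⟩[ τ , γ ] →
                ∃ λ F₁ → 𝓕 F₁ × (⟦ M ⟧ ⊆ ⟨ ⟦ F₁ ⟧ ⟩[ τ , γ ]) × (⟦ F₁ ⟧ ⊆ ⟨ ⟦ F ⟧ ⟩[ τ , γ ])

Nonempty : {X : Set} → Subset X → Set
Nonempty U = ∃ λ x → x ∈ U

IsFRegularOpen : {X : Set} (τ γ : Subset X → Subset X) (𝓕 : List X → Set) → Subset X → Set
IsFRegularOpen {X} τ γ 𝓕 U =
  Nonempty U ×
  (∀ (M : List X) → ⟦ M ⟧ ⊆ U →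
     ∃ λ F → 𝓕 F × (⟦ M ⟧ ⊆ ⟨ ⟦ F ⟧ ⟩[ τ , γ ]) × (⟨ ⟦ F ⟧ ⟩[ τ , γ ] ⊆ U))

-- An indexed family of subsets  S : I → Subset X  (members S i, i ∈ I).
-- Directed w.r.t. inclusion: nonempty, any two members contained in a common member.
Directed : {X I : Set} → (I → Subset X) → Set
Directed {I = I} S = I × (∀ i j → ∃ λ k → (S i ⊆ S k) × (S j ⊆ S k))

⋃ : {X I : Set} → (I → Subset X) → Subset X
⋃ {I = I} S = λ x → ∃ λ (i : I) → x ∈ S i

-- Index set of the family {⟨F⟩ : F ∈ 𝓕, F ⊆ U}.
FamIndex : {X : Set} (𝓕 : List X → Set) → Subset X → Set
FamIndex {X} 𝓕 U = Σ (List X) λ F → 𝓕 F × (⟦ F ⟧ ⊆ U)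

famOf : {X : Set} (τ γ : Subset X → Subset X) (𝓕 : List X → Set) (U : Subset X) →
        FamIndex 𝓕 U → Subset X
famOf τ γ 𝓕 U (F , _) = ⟨ ⟦ F ⟧ ⟩[ τ , γ ]

module Submission where

-- Both conditions are reformulated through one intermediate notion: a family
-- of sets S "finitely covers" U when every finite M ⊆ U lies inside a single
-- member of S.

open import Defs
open import Data.List using (List; []; _∷_; _++_)
open import Data.List.Membership.Propositional.Properties using (∈-++⁺ˡ; ∈-++⁺ʳ; ∈-++⁻)
open import Data.List.Relation.Unary.Any using (here; there)
open import Data.Product using (_×_; _,_; proj₁; proj₂; ∃)
open import Data.Sum using ([_,_])
open import Function.Bundles using (_⇔_; mk⇔)
open import Relation.Binary.PropositionalEquality using (refl)
open import Relation.Unary using (_⊆_)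

FinitelyCovers : {X I : Set} → (I → Subset X) → Subset X → Set
FinitelyCovers {X} {I} S U = ∀ (M : List X) → ⟦ M ⟧ ⊆ U → ∃ λ (i : I) → ⟦ M ⟧ ⊆ S i

MembersWithin : {X I : Set} → (I → Subset X) → Subset X → Set
MembersWithin {I = I} S U = ∀ (i : I) → S i ⊆ U

⟦++⟧-⊆ : {X : Set} {A : Subset X} (F G : List X) → ⟦ F ⟧ ⊆ A → ⟦ G ⟧ ⊆ A → ⟦ F ++ G ⟧ ⊆ A
⟦++⟧-⊆ F G F⊆A G⊆A x∈F++G = [ F⊆A , G⊆A ] (∈-++⁻ F x∈F++G)

-- A directed family finitely covers its union: by induction on M, joining the
-- member containing the head with the member containing the tail.
directed⇒finitelyCovers : {X I : Set} (S : I → Subset X) → Directed S → FinitelyCovers S (⋃ S)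
directed⇒finitelyCovers S (i₀ , _) [] _ = i₀ , λ ()
directed⇒finitelyCovers S dir@(_ , join) (x ∷ M) x∷M⊆⋃
  with x∷M⊆⋃ (here refl) | directed⇒finitelyCovers S dir M (λ p → x∷M⊆⋃ (there p))
... | i , x∈Si | j , M⊆Sj with join i j
...   | k , Si⊆Sk , Sj⊆Sk = k , λ { (here refl) → Si⊆Sk x∈Si ; (there p) → Sj⊆Sk (M⊆Sj p) }

-- A family of subsets of U which finitely covers U has union exactly U
-- (cover each point by the singleton list).
finitelyCovers⇒⋃≐ : {X I : Set} (S : I → Subset X) (U : Subset X) →
  FinitelyCovers S U → MembersWithin S U → ⋃ S ≐ U
finitelyCovers⇒⋃≐ S U cover within =
  (λ { (i , x∈Si) → within i x∈Si }) ,
  λ {x} x∈U → let (i , x∈Si) = cover (x ∷ []) (λ { (here refl) → x∈U }) in i , x∈Si (here refl)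

module _ {X : Set} {τ γ : Subset X → Subset X} (gcs : IsGenClosureSpace τ γ) where
  open IsGenClosureSpace gcs
  open IsClosureOperator closure

  -- Absorption: ⟨B⟩ is closed for ⟨_⟩ relative to its subsets, since
  -- ⟨A⟩ ⊆ τ(γ(τ(γ B))) ⊆ τ(γ(γ B)) = τ(γ B).
  ⟨⟩-absorb : ∀ {A B} → A ⊆ ⟨ B ⟩[ τ , γ ] → ⟨ A ⟩[ τ , γ ] ⊆ ⟨ B ⟩[ τ , γ ]
  ⟨⟩-absorb {A} {B} A⊆⟨B⟩ x∈⟨A⟩ =
    proj₁ (τ-resp-≐ (idempotent B)) (τγ-mono (τ-deflat B) (τγ-mono A⊆⟨B⟩ x∈⟨A⟩))

  -- If the family {⟨F⟩ : F ∈ 𝓕, F ⊆ U} finitely covers U it is directed: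
  -- two members ⟨F⟩, ⟨G⟩ lie below a member ⟨H⟩ with F ∪ G ⊆ ⟨H⟩.
  finitelyCovers⇒directed : (𝓕 : List X → Set) (U : Subset X) →
    FinitelyCovers (famOf τ γ 𝓕 U) U → Directed (famOf τ γ 𝓕 U)
  finitelyCovers⇒directed 𝓕 U cover = proj₁ (cover [] (λ ())) , join
    where
    join : ∀ i j → ∃ λ k → (famOf τ γ 𝓕 U i ⊆ famOf τ γ 𝓕 U k) × (famOf τ γ 𝓕 U j ⊆ famOf τ γ 𝓕 U k)
    join (F , _ , F⊆U) (G , _ , G⊆U) with cover (F ++ G) (⟦++⟧-⊆ F G F⊆U G⊆U)
    ... | k , F++G⊆k = k , ⟨⟩-absorb (λ p → F++G⊆k (∈-++⁺ˡ p)) , ⟨⟩-absorb (λ p → F++G⊆k (∈-++⁺ʳ F p))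

module _ {X : Set} {τ γ : Subset X → Subset X} {𝓕 : List X → Set}
         (aug : IsFAugmented τ γ 𝓕) (U : Subset X) (reg : IsFRegularOpen τ γ 𝓕 U) where
  open IsFAugmented aug

  -- Members of the family lie in U: F ⊆ U gives F ⊆ ⟨F'⟩ ⊆ U by regularity,
  -- hence ⟨F⟩ ⊆ ⟨F'⟩ ⊆ U by absorption.
  regular⇒membersWithin : MembersWithin (famOf τ γ 𝓕 U) U
  regular⇒membersWithin (F , _ , F⊆U) with proj₂ reg F F⊆U
  ... | _ , _ , F⊆⟨F'⟩ , ⟨F'⟩⊆U = λ p → ⟨F'⟩⊆U (⟨⟩-absorb gcs F⊆⟨F'⟩ p)

  -- Regularity gives M ⊆ ⟨F⟩ ⊆ U with F ∈ 𝓕 but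
  -- possibly F ⊄ U; augmentation replaces F by F₁ ∈ 𝓕 with M ⊆ ⟨F₁⟩ and
  -- F₁ ⊆ ⟨F⟩ ⊆ U, which is an index of the family.
  regular⇒finitelyCovers : FinitelyCovers (famOf τ γ 𝓕 U) U
  regular⇒finitelyCovers M M⊆U with proj₂ reg M M⊆U
  ... | F , F∈𝓕 , M⊆⟨F⟩ , ⟨F⟩⊆U with augmented F F∈𝓕 M M⊆⟨F⟩
  ...   | F₁ , F₁∈𝓕 , M⊆⟨F₁⟩ , F₁⊆⟨F⟩ = (F₁ , F₁∈𝓕 , λ p → ⟨F⟩⊆U (F₁⊆⟨F⟩ p)) , M⊆⟨F₁⟩

finitelyCovers⇒regular : {X : Set} (τ γ : Subset X → Subset X) (𝓕 : List X → Set) (U : Subset X) →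
  Nonempty U → FinitelyCovers (famOf τ γ 𝓕 U) U → MembersWithin (famOf τ γ 𝓕 U) U →
  IsFRegularOpen τ γ 𝓕 U
finitelyCovers⇒regular τ γ 𝓕 U ne cover within = ne , λ M M⊆U →
  let (i@(F , F∈𝓕 , _) , M⊆⟨F⟩) = cover M M⊆U in F , F∈𝓕 , M⊆⟨F⟩ , within i

proposition3p12 : {X : Set} (τ γ : Subset X → Subset X) (𝓕 : List X → Set) →
    IsFAugmented τ γ 𝓕 → (U : Subset X) → Nonempty U →
    IsFRegularOpen τ γ 𝓕 U ⇔ (Directed (famOf τ γ 𝓕 U) × (⋃ (famOf τ γ 𝓕 U) ≐ U))
proposition3p12 τ γ 𝓕 aug U ne = mk⇔ regular⇒directed directed⇒regular
  where
  S : FamIndex 𝓕 U → Subset _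
  S = famOf τ γ 𝓕 U
  regular⇒directed : IsFRegularOpen τ γ 𝓕 U → Directed S × (⋃ S ≐ U)
  regular⇒directed reg =
    finitelyCovers⇒directed (IsFAugmented.gcs aug) 𝓕 U cover ,
    finitelyCovers⇒⋃≐ S U cover (regular⇒membersWithin aug U reg)
    where
    cover : FinitelyCovers S U
    cover = regular⇒finitelyCovers aug U reg
  directed⇒regular : Directed S × (⋃ S ≐ U) → IsFRegularOpen τ γ 𝓕 U
  directed⇒regular (dir , (⋃⊆U , U⊆⋃)) =
    finitelyCovers⇒regular τ γ 𝓕 U ne
      (λ M M⊆U → directed⇒finitelyCovers S dir M (λ p → U⊆⋃ (M⊆U p)))
      (λ i p → ⋃⊆U (i , p))
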